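{- Let $q$ be a prime power and $n,k_1,k_2,t$ positive integers with $n\geq k_1+k_2+t+3$, $k_1\geq k_2\geq t+1$, $k_2=t+1$, and $(k_1,k_2)\notin\{(2,2),(3,2),(4,2)\}$. Then $g_1(k_1,k_2,n,t)g_2(k_2,n,t)<g_3(k_1,k_2,n,t)$, where $g_1(k,\ell,n,t)={n-t\brack k-t}-q^{(\ell+1-t)(k-t)}{n-\ell-1\brack k-t}$, $g_2(\ell,n,t)={n-t\brack \ell-t}+q^{\ell+1-t}{t\brack 1}$, and $g_3(k,\ell,n,t)={n-t-1\brack k-t-1}\left(q^{\ell-t}{t+1\brack 1}{n-t-1\brack \ell-t}+{n-t-1\brack \ell-t-1}\right)$.
   Context: Gaussian binomial coefficient: ${a\brack b}=\prod_{0\leq i<b}\frac{q^{a-i}-1}{q^{b-i}-1}$ for positive integers $a,b$, with ${a\brack 0}=1$ and ${a\brack c}=0$ for negative $c$. -}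

module Defs where

open import Data.Nat as ℕ using (ℕ; zero; suc; _∸_; _^_; _≥_)
open import Data.Nat.Primality using (Prime)
open import Data.Integer as ℤ using (ℤ; +_)
open import Data.Rational as ℚ using (ℚ; _/_; 0ℚ; 1ℚ)
open import Data.Product using (Σ; _×_)
open import Relation.Binary.PropositionalEquality using (_≡_)

IsPrimePower : ℕ → Set
IsPrimePower q = Σ ℕ λ p → Σ ℕ λ e → Prime p × e ≥ 1 × q ≡ p ^ e

ℕ→ℚ : ℕ → ℚ
ℕ→ℚ n = + n / 1

-- the fraction x / d (d a natural number); set to 0 when d = 0.
-- In the Gaussian binomial below, d = q^(b-i) - 1 with b-i ≥ 1, so d ≠ 0 whenever q ≥ 2.
frac : ℤ → ℕ → ℚ
frac x zero = 0ℚ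
frac x (suc d) = x / suc d

factor : ℕ → ℕ → ℕ → ℕ → ℚ
factor q a b i = frac (+ (q ^ (a ∸ i)) ℤ.- + 1) ((q ^ (b ∸ i)) ∸ 1)

prodUpTo : ℕ → ℕ → ℕ → ℕ → ℚ
prodUpTo q a b zero = 1ℚ
prodUpTo q a b (suc m) = prodUpTo q a b m ℚ.* factor q a b m

-- Gaussian binomial [a brack b]_q = ∏_{0 ≤ i < b} (q^(a-i) - 1)/(q^(b-i) - 1); equals 1 for b = 0.
-- (Whenever a < b the factor at i = a vanishes, so truncated subtraction a ∸ i is harmless.)
gauss : ℕ → ℕ → ℕ → ℚ
gauss q a b = prodUpTo q a b b

g₁ : ℕ → ℕ → ℕ → ℕ → ℕ → ℚ
g₁ q k ℓ n t = gauss q (n ∸ t) (k ∸ t)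
  ℚ.- ℕ→ℚ (q ^ (((ℓ ℕ.+ 1) ∸ t) ℕ.* (k ∸ t))) ℚ.* gauss q ((n ∸ ℓ) ∸ 1) (k ∸ t)

g₂ : ℕ → ℕ → ℕ → ℕ → ℚ
g₂ q ℓ n t = gauss q (n ∸ t) (ℓ ∸ t)
  ℚ.+ ℕ→ℚ (q ^ ((ℓ ℕ.+ 1) ∸ t)) ℚ.* gauss q t 1

g₃ : ℕ → ℕ → ℕ → ℕ → ℕ → ℚ
g₃ q k ℓ n t = gauss q ((n ∸ t) ∸ 1) ((k ∸ t) ∸ 1)
  ℚ.* (ℕ→ℚ (q ^ (ℓ ∸ t)) ℚ.* gauss q (t ℕ.+ 1) 1 ℚ.* gauss q ((n ∸ t) ∸ 1) (ℓ ∸ t)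
       ℚ.+ gauss q ((n ∸ t) ∸ 1) ((ℓ ∸ t) ∸ 1))

-- Write m = n − t, K = k₁ − t, k = q^K, x = q^(m−1), s = q^t and P = [m−1, K−1] > 0. The identities
-- [a+1, b+1](q^(b+1) − 1) = (q^(a+1) − 1)[a, b] and [a+b+1, b](q^(a+1) − 1) = (q^(a+b+1) − 1)[a+b, b]
-- put all three sides over P:
--   g₁ = P((q+1)x − k − 1)/(x − 1),   (q − 1)g₂ = qx − 1 + q²(s − 1),
--   (q − 1)²g₃ = P(q(qs − 1)(x − 1) + (q − 1)²).
-- So the claim is the polynomial inequality
--   (q − 1)((q+1)x − k − 1)(qx − 1 + q²(s − 1)) < q(qs − 1)(x − 1)² + (q − 1)²(x − 1),
-- and once the lower bounds on k, x and s are substituted, the difference of the two sides is a polynomial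
-- with nonnegative coefficients and positive constant term. For t = 1 (s = q) its coefficient of x is a
-- multiple of q^K + 1 − q³ − q, which is why K ≥ 4, i.e. k₁ ∉ {2, 3, 4}, is needed.

module Submission where

open import Defs
open import Data.Empty using (⊥-elim)
open import Data.Integer as ℤ using (+_)
import Data.Integer.Properties as ℤ
import Data.Integer.Tactic.RingSolver as ℤ-Solver
open import Data.Nat as ℕ using (ℕ; zero; suc; z<s)
open import Data.Nat.Primality using (prime⇒nonTrivial; prime⇒nonZero)
import Data.Nat.Properties as ℕ
open import Data.Nat.Tactic.RingSolver using (solve-∀)
open import Data.Product using (_,_)
open import Data.Rational as ℚ using (ℚ; 1ℚ; Positive; NonNegative)
import Data.Rational.Properties as ℚ
open import Data.Rational.Solver using (module +-*-Solver)
import Data.Rational.Unnormalised as ℚᵘ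
import Data.Rational.Unnormalised.Properties as ℚᵘ
open import Relation.Binary.PropositionalEquality

module _ where
  open import Data.Rational using (_+_; _*_; _-_; _<_)

  fromℚᵘ-homo-+ : ∀ x y → ℚ.fromℚᵘ (x ℚᵘ.+ y) ≡ ℚ.fromℚᵘ x + ℚ.fromℚᵘ y
  fromℚᵘ-homo-+ x y = ℚ.toℚᵘ-injective (ℚᵘ.≃-trans (ℚ.toℚᵘ-fromℚᵘ (x ℚᵘ.+ y)) (ℚᵘ.≃-sym
    (ℚᵘ.≃-trans (ℚ.toℚᵘ-homo-+ (ℚ.fromℚᵘ x) (ℚ.fromℚᵘ y))
                (ℚᵘ.+-cong (ℚ.toℚᵘ-fromℚᵘ x) (ℚ.toℚᵘ-fromℚᵘ y)))))

  fromℚᵘ-homo-* : ∀ x y → ℚ.fromℚᵘ (x ℚᵘ.* y) ≡ ℚ.fromℚᵘ x * ℚ.fromℚᵘ y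
  fromℚᵘ-homo-* x y = ℚ.toℚᵘ-injective (ℚᵘ.≃-trans (ℚ.toℚᵘ-fromℚᵘ (x ℚᵘ.* y)) (ℚᵘ.≃-sym
    (ℚᵘ.≃-trans (ℚ.toℚᵘ-homo-* (ℚ.fromℚᵘ x) (ℚ.fromℚᵘ y))
                (ℚᵘ.*-cong (ℚ.toℚᵘ-fromℚᵘ x) (ℚ.toℚᵘ-fromℚᵘ y)))))

  ℕ→ℚᵘ : ℕ → ℚᵘ.ℚᵘ
  ℕ→ℚᵘ n = ℚᵘ.mkℚᵘ (+ n) 0

  ℕ→ℚ-+ : ∀ m n → ℕ→ℚ (m ℕ.+ n) ≡ ℕ→ℚ m + ℕ→ℚ n
  ℕ→ℚ-+ m n = trans (ℚ.fromℚᵘ-cong {ℕ→ℚᵘ (m ℕ.+ n)} {ℕ→ℚᵘ m ℚᵘ.+ ℕ→ℚᵘ n} (ℚᵘ.*≡* eq))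
                     (fromℚᵘ-homo-+ (ℕ→ℚᵘ m) (ℕ→ℚᵘ n))
    where
    over-1 : ∀ a b → (a ℤ.+ b) ℤ.* + 1 ≡ (a ℤ.* + 1 ℤ.+ b ℤ.* + 1) ℤ.* + 1
    over-1 = ℤ-Solver.solve-∀
    eq : + (m ℕ.+ n) ℤ.* + 1 ≡ (+ m ℤ.* + 1 ℤ.+ + n ℤ.* + 1) ℤ.* + 1
    eq = trans (cong (ℤ._* + 1) (ℤ.pos-+ m n)) (over-1 (+ m) (+ n))

  ℕ→ℚ-* : ∀ m n → ℕ→ℚ (m ℕ.* n) ≡ ℕ→ℚ m * ℕ→ℚ n
  ℕ→ℚ-* m n = trans (ℚ.fromℚᵘ-cong {ℕ→ℚᵘ (m ℕ.* n)} {ℕ→ℚᵘ m ℚᵘ.* ℕ→ℚᵘ n}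
                                    (ℚᵘ.*≡* (cong (ℤ._* + 1) (ℤ.pos-* m n))))
                     (fromℚᵘ-homo-* (ℕ→ℚᵘ m) (ℕ→ℚᵘ n))

  ℕ→ℚ-*₃ : ∀ a b c → ℕ→ℚ (a ℕ.* b ℕ.* c) ≡ ℕ→ℚ a * ℕ→ℚ b * ℕ→ℚ c
  ℕ→ℚ-*₃ a b c = trans (ℕ→ℚ-* (a ℕ.* b) c) (cong (_* ℕ→ℚ c) (ℕ→ℚ-* a b))

  ℕ→ℚ-+-cancelʳ : ∀ m n → ℕ→ℚ (m ℕ.+ n) - ℕ→ℚ n ≡ ℕ→ℚ m
  ℕ→ℚ-+-cancelʳ m n = trans (cong (_- ℕ→ℚ n) (ℕ→ℚ-+ m n)) (cancel (ℕ→ℚ m) (ℕ→ℚ n))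
    where
    open +-*-Solver
    cancel : ∀ a b → a + b - b ≡ a
    cancel = solve 2 (λ a b → a :+ b :- b := a) refl

  ℕ→ℚ-mono-< : ∀ {m n} → m ℕ.< n → ℕ→ℚ m < ℕ→ℚ n
  ℕ→ℚ-mono-< {m} {n} m<n = ℚ.toℚᵘ-cancel-<
    (ℚᵘ.<-respʳ-≃ (ℚᵘ.≃-sym (ℚ.toℚᵘ-fromℚᵘ (ℕ→ℚᵘ n)))
    (ℚᵘ.<-respˡ-≃ (ℚᵘ.≃-sym (ℚ.toℚᵘ-fromℚᵘ (ℕ→ℚᵘ m))) (ℚᵘ.*<* lt)))
    where
    lt : + m ℤ.* + 1 ℤ.< + n ℤ.* + 1
    lt rewrite ℤ.*-identityʳ (+ m) | ℤ.*-identityʳ (+ n) = ℤ.+<+ m<n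

  ℕ→ℚ-nonNeg : ∀ n → NonNegative (ℕ→ℚ n)
  ℕ→ℚ-nonNeg n = ℚ.normalize-nonNeg n 1

  frac-*-cancel : ∀ n d → frac (+ n) (suc d) * ℕ→ℚ (suc d) ≡ ℕ→ℚ n
  frac-*-cancel n d = trans (sym (fromℚᵘ-homo-* (ℚᵘ.mkℚᵘ (+ n) d) (ℕ→ℚᵘ (suc d))))
    (ℚ.fromℚᵘ-cong {ℚᵘ.mkℚᵘ (+ n) d ℚᵘ.* ℕ→ℚᵘ (suc d)} {ℕ→ℚᵘ n} (ℚᵘ.*≡* (eq (+ n) (+ suc d))))
    where
    eq : ∀ a b → (a ℤ.* b) ℤ.* + 1 ≡ a ℤ.* (b ℤ.* + 1)
    eq = ℤ-Solver.solve-∀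

  frac-split : ∀ n d → frac (+ n) d ≡ ℕ→ℚ n * frac (+ 1) d
  frac-split n zero    = sym (ℚ.*-zeroʳ (ℕ→ℚ n))
  frac-split n (suc d) = trans
    (ℚ.fromℚᵘ-cong {ℚᵘ.mkℚᵘ (+ n) d} {ℕ→ℚᵘ n ℚᵘ.* ℚᵘ.mkℚᵘ (+ 1) d} (ℚᵘ.*≡* eq))
    (fromℚᵘ-homo-* (ℕ→ℚᵘ n) (ℚᵘ.mkℚᵘ (+ 1) d))
    where
    eq : + n ℤ.* + suc (d ℕ.+ 0) ≡ (+ n ℤ.* + 1) ℤ.* + suc d
    eq rewrite ℕ.+-identityʳ d | ℤ.*-identityʳ (+ n) = refl

module _ where
  open import Data.Nat using (_+_; _*_; _^_)

  -- q ^ e ∸ 1 for q = suc p, by the recursion q^(e+1) − 1 = p + q (q^e − 1), which needs no subtraction.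
  predPow : ℕ → ℕ → ℕ
  predPow p zero    = 0
  predPow p (suc e) = p + suc p * predPow p e

  suc-predPow : ∀ p e → suc (predPow p e) ≡ suc p ^ e
  suc-predPow p zero    = refl
  suc-predPow p (suc e) = trans (step p (predPow p e)) (cong (suc p *_) (suc-predPow p e))
    where
    step : ∀ p c → suc (p + suc p * c) ≡ suc p * suc c
    step = solve-∀

  infixl 6 _⊕_
  _⊕_ : ℕ → ℕ → ℕ
  x ⊕ y = x + suc x * y

  predPow-+ : ∀ p a b → predPow p (a + b) ≡ predPow p a ⊕ predPow p b
  predPow-+ p zero    b = sym (ℕ.+-identityʳ (predPow p b))
  predPow-+ p (suc a) b =
    trans (cong (λ c → p + suc p * c) (predPow-+ p a b)) (step p (predPow p a) (predPow p b))
    where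
    step : ∀ p x y → p + suc p * (x + suc x * y) ≡ (p + suc p * x) + suc (p + suc p * x) * y
    step = solve-∀

module _ where
  open import Data.Rational using (_*_)

  predPowℚ : ℕ → ℕ → ℚ
  predPowℚ p e = ℕ→ℚ (predPow p e)

  prodUpTo-peel : ∀ q a b j →
    prodUpTo q (suc a) (suc b) (suc j) ≡ factor q (suc a) (suc b) 0 * prodUpTo q a b j
  prodUpTo-peel q a b zero    = trans (ℚ.*-identityˡ f₀) (sym (ℚ.*-identityʳ f₀))
    where
    f₀ : ℚ
    f₀ = factor q (suc a) (suc b) 0
  prodUpTo-peel q a b (suc j) =
    trans (cong (_* factor q a b j) (prodUpTo-peel q a b j))
          (ℚ.*-assoc (factor q (suc a) (suc b) 0) (prodUpTo q a b j) (factor q a b j))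

  module _ (p : ℕ) where

    factor-predPow : ∀ a b i →
      factor (suc p) a b i ≡ frac (+ predPow p (a ℕ.∸ i)) (predPow p (b ℕ.∸ i))
    factor-predPow a b i rewrite sym (suc-predPow p (a ℕ.∸ i)) | sym (suc-predPow p (b ℕ.∸ i)) = refl

    prodUpTo-shift : ∀ a b j →
      prodUpTo (suc p) (suc a) b j * predPowℚ p (suc a ℕ.∸ j) ≡ prodUpTo (suc p) a b j * predPowℚ p (suc a)
    prodUpTo-shift a b zero    = refl
    prodUpTo-shift a b (suc j) = begin
      Π′ * factor (suc p) (suc a) b j * c (a ℕ.∸ j) ≡⟨ cong (λ f → Π′ * f * c (a ℕ.∸ j)) (factor-split (suc a)) ⟩
      Π′ * (c (suc a ℕ.∸ j) * w) * c (a ℕ.∸ j)      ≡⟨ regroup Π′ (c (suc a ℕ.∸ j)) w (c (a ℕ.∸ j)) ⟩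
      (Π′ * c (suc a ℕ.∸ j)) * (w * c (a ℕ.∸ j))    ≡⟨ cong (_* (w * c (a ℕ.∸ j))) (prodUpTo-shift a b j) ⟩
      (Π * c (suc a)) * (w * c (a ℕ.∸ j))           ≡⟨ regroup′ Π (c (suc a)) w (c (a ℕ.∸ j)) ⟩
      Π * (c (a ℕ.∸ j) * w) * c (suc a)             ≡⟨ cong (λ f → Π * f * c (suc a)) (sym (factor-split a)) ⟩
      Π * factor (suc p) a b j * c (suc a)          ∎
      where
      open ≡-Reasoning
      open +-*-Solver
      c : ℕ → ℚ
      c = predPowℚ p
      Π Π′ w : ℚ
      Π = prodUpTo (suc p) a b j
      Π′ = prodUpTo (suc p) (suc a) b j
      w = frac (+ 1) (predPow p (b ℕ.∸ j))
      factor-split : ∀ a → factor (suc p) a b j ≡ c (a ℕ.∸ j) * w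
      factor-split a = trans (factor-predPow a b j) (frac-split (predPow p (a ℕ.∸ j)) (predPow p (b ℕ.∸ j)))
      regroup : ∀ x y z v → x * (y * z) * v ≡ (x * y) * (z * v)
      regroup = solve 4 (λ x y z v → x :* (y :* z) :* v := (x :* y) :* (z :* v)) refl
      regroup′ : ∀ x y z v → (x * y) * (z * v) ≡ x * (v * z) * y
      regroup′ = solve 4 (λ x y z v → (x :* y) :* (z :* v) := x :* (v :* z) :* y) refl

    gauss-shift : ∀ a b →
      gauss (suc p) (suc (a ℕ.+ b)) b * predPowℚ p (suc a) ≡ predPowℚ p (suc (a ℕ.+ b)) * gauss (suc p) (a ℕ.+ b) b
    gauss-shift a b = begin
      gauss (suc p) (suc (a ℕ.+ b)) b * predPowℚ p (suc a)
        ≡⟨ cong (λ e → gauss (suc p) (suc (a ℕ.+ b)) b * predPowℚ p e) (sym (ℕ.m+n∸n≡m (suc a) b)) ⟩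
      gauss (suc p) (suc (a ℕ.+ b)) b * predPowℚ p (suc (a ℕ.+ b) ℕ.∸ b)
        ≡⟨ prodUpTo-shift (a ℕ.+ b) b b ⟩
      gauss (suc p) (a ℕ.+ b) b * predPowℚ p (suc (a ℕ.+ b))
        ≡⟨ ℚ.*-comm (gauss (suc p) (a ℕ.+ b) b) (predPowℚ p (suc (a ℕ.+ b))) ⟩
      predPowℚ p (suc (a ℕ.+ b)) * gauss (suc p) (a ℕ.+ b) b ∎
      where open ≡-Reasoning

  module _ (u : ℕ) where

    gauss-absorb : ∀ a b →
      gauss (suc (suc u)) (suc a) (suc b) * predPowℚ (suc u) (suc b) ≡ predPowℚ (suc u) (suc a) * gauss (suc (suc u)) a b
    gauss-absorb a b = begin
      gauss (suc (suc u)) (suc a) (suc b) * c (suc b) ≡⟨ cong (_* c (suc b)) (prodUpTo-peel (suc (suc u)) a b b) ⟩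
      f₀ * G * c (suc b)                              ≡⟨ swap f₀ G (c (suc b)) ⟩
      f₀ * c (suc b) * G                              ≡⟨ cong (_* G) f₀-cancel ⟩
      c (suc a) * G                                   ∎
      where
      open ≡-Reasoning
      open +-*-Solver
      c : ℕ → ℚ
      c = predPowℚ (suc u)
      f₀ G : ℚ
      f₀ = factor (suc (suc u)) (suc a) (suc b) 0
      G = gauss (suc (suc u)) a b
      swap : ∀ x y z → x * y * z ≡ x * z * y
      swap = solve 3 (λ x y z → x :* y :* z := x :* z :* y) refl
      f₀-cancel : f₀ * c (suc b) ≡ c (suc a)
      f₀-cancel = trans (cong (_* c (suc b)) (factor-predPow (suc u) (suc a) (suc b) 0))
                        (frac-*-cancel (predPow (suc u) (suc a)) _)

    gauss-one : ∀ a → gauss (suc (suc u)) a 1 * predPowℚ (suc u) 1 ≡ predPowℚ (suc u) a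
    gauss-one a =
      trans (cong (_* predPowℚ (suc u) 1) (trans (ℚ.*-identityˡ (factor (suc (suc u)) a 1 0))
                                                (factor-predPow (suc u) a 1 0)))
            (frac-*-cancel (predPow (suc u) a) _)

    gauss-pos : ∀ a b → b ℕ.≤ a → Positive (gauss (suc (suc u)) a b)
    gauss-pos a b b≤a = prodUpTo-pos b ℕ.≤-refl
      where
      frac-pos : ∀ x y → .{{ℕ.NonZero x}} → .{{ℕ.NonZero y}} →
                 Positive (frac (+ predPow (suc u) x) (predPow (suc u) y))
      frac-pos (suc x) (suc y) = ℚ.normalize-pos (predPow (suc u) (suc x)) (predPow (suc u) (suc y))
      factor-pos : ∀ i → i ℕ.< b → Positive (factor (suc (suc u)) a b i)
      factor-pos i i<b = subst Positive (sym (factor-predPow (suc u) a b i))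
        (frac-pos (a ℕ.∸ i) (b ℕ.∸ i) {{ℕ.≢-nonZero (ℕ.m>n⇒m∸n≢0 (ℕ.<-≤-trans i<b b≤a))}}
                                      {{ℕ.≢-nonZero (ℕ.m>n⇒m∸n≢0 i<b)}})
      prodUpTo-pos : ∀ j → j ℕ.≤ b → Positive (prodUpTo (suc (suc u)) a b j)
      prodUpTo-pos zero    _   = _
      prodUpTo-pos (suc j) j<b = ℚ.pos*pos⇒pos (prodUpTo (suc (suc u)) a b j) {{prodUpTo-pos j (ℕ.<⇒≤ j<b)}}
                                               (factor (suc (suc u)) a b j) {{factor-pos j j<b}}

module _ where
  open import Data.Nat using (_+_; _*_; _<_)

  -- With q = suc p, κ = q^K − 1, η = q^e − 1, τ = q^t − 1 and χ = η ⊕ κ = q^(K+e) − 1: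
  -- A = (q+1)q^(K+e) − q^K − 1, B = (q − 1)g₂ and R·P = (q − 1)²χ·g₃.
  A : ℕ → ℕ → ℕ → ℕ
  A p κ η = suc p * κ + p + suc (suc p) * suc κ * η

  B : ℕ → ℕ → ℕ → ℕ
  B p χ τ = p + suc p * χ + suc p * suc p * τ

  R : ℕ → ℕ → ℕ → ℕ
  R p χ τ = suc p * (p + suc p * τ) * χ * χ + p * p * χ

  PolynomialInequality : ℕ → ℕ → ℕ → ℕ → Set
  PolynomialInequality p κ η τ = p * A p κ η * B p (η ⊕ κ) τ < R p (η ⊕ κ) τ

  A-identity : ∀ p κ η →
    (p + suc p * (η ⊕ κ)) * (η ⊕ κ) ≡ κ * A p κ η + suc κ * suc κ * η * (p + suc p * η)
  A-identity = expanded
    where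
    -- solve-∀ does not unfold definitions, so the identity is proved in expanded form.
    expanded : ∀ p κ η → let χ = η + suc η * κ in
      (p + suc p * χ) * χ ≡ κ * (suc p * κ + p + suc (suc p) * suc κ * η) + suc κ * suc κ * η * (p + suc p * η)
    expanded = solve-∀

  polynomialInequality-t≡1 : ∀ u K η →
    PolynomialInequality (suc u) (predPow (suc u) (4 + K)) η (predPow (suc u) 1)
  polynomialInequality-t≡1 u K η =
    ℕ.<-≤-trans (ℕ.m<m+n _ z<s) (ℕ.≤-reflexive (sym (certificate u (predPow (suc u) K) η)))
    where
    -- R − pAB = p(qxα + q² + 1 + (k+1)β) with k = q^K, x = q^(K+e), α = k + 1 − q³ − q and β = q³ − q² − 1.
    certificate : ∀ u κ′ η →
      let p = suc u
          q = suc p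
          κ = p + q * (p + q * (p + q * (p + q * κ′)))
          τ = p + q * 0
          χ = η + suc η * κ
          α = p * (p * (q * q + q + 1)) + q * q * q * q * κ′
          β = q * q * u + p * (q + 1)
      in q * (p + q * τ) * χ * χ + p * p * χ
         ≡ p * (q * κ + p + suc q * suc κ * η) * (p + q * χ + q * q * τ)
           + p * suc (q * suc χ * α + q * q + (κ + 2) * β)
    certificate = solve-∀

  polynomialInequality-t≥2 : ∀ u K e t →
    PolynomialInequality (suc u) (predPow (suc u) (suc K)) (predPow (suc u) (2 + e)) (predPow (suc u) (2 + t))
  polynomialInequality-t≥2 u K e t = ℕ.<-≤-trans (ℕ.m<m+n _ z<s)
    (ℕ.≤-reflexive (sym (certificate u (predPow (suc u) K) (predPow (suc u) e) (predPow (suc u) t))))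
    where
    -- R − pAB = p(qxγ + q² + 1 + (k+1)β + q³(1 + p(k+1))) + q²(s − q²)E with k = q^K, x = q^(K+e),
    -- γ = q²x + k + 1 − q⁴ − q³ − q² − q, β = q³ − q² − 1 and E = x(x − q² − 1) + 1 + p(k+1),
    -- all nonnegative because k ≥ q, x ≥ q²k and s ≥ q².
    certificate : ∀ u κ′ η′ τ′ →
      let p = suc u
          q = suc p
          κ = p + q * κ′
          η = p + q * (p + q * η′)
          τ = p + q * (p + q * τ′)
          k = suc κ
          χ = η + suc η * κ
          x = suc χ
          a = q * κ′
          z = k * q * q * η′
          γ = q * q * (1 + u + q * u + q * q * u) + q * q * q * q * a + q * q * z + a + 1
          β = q * q * u + p * (q + 1)
          ξ = q * q * (u + a) + p * (q + 1) + z
          E = x * ξ + 1 + p * (k + 1)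
      in q * (p + q * τ) * χ * χ + p * p * χ
         ≡ p * (q * κ + p + suc q * k * η) * (p + q * χ + q * q * τ)
           + (p * suc (q * x * γ + q * q + (k + 1) * β + q * q * q * (1 + p * (k + 1))) + q * q * (q * q * τ′) * E)
    certificate = solve-∀

-- q = u + 2, k₁ = t + K and n = t + m, where K = K′ + 1, m = K + e + 1 and e = e′ + 2;
-- X, Y and Z are g₁, g₂ and g₃ with the offset t removed from their indices.
module Reduction (u t K′ e′ : ℕ) where
  open import Data.Rational using (_+_; _*_; _-_; _<_)
  open +-*-Solver
  open ≡-Reasoning

  p q K e m κ η τ χ : ℕ
  p = suc u
  q = suc p
  K = suc K′
  e = suc (suc e′)
  m = suc (suc (e ℕ.+ K′))
  κ = predPow p K
  η = predPow p e
  τ = predPow p t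
  χ = predPow p (suc (e ℕ.+ K′))

  c : ℕ → ℚ
  c = predPowℚ p

  P G₀ G₁ X Y Z : ℚ
  P = gauss q (suc (e ℕ.+ K′)) K′
  G₀ = gauss q (e ℕ.+ K′) K′
  G₁ = gauss q (suc e′ ℕ.+ K′) K′
  X = gauss q m K - ℕ→ℚ (q ℕ.^ (2 ℕ.* K)) * gauss q (e ℕ.+ K′) K
  Y = gauss q m 1 + ℕ→ℚ (q ℕ.^ 2) * gauss q t 1
  Z = P * (ℕ→ℚ (q ℕ.^ 1) * gauss q (t ℕ.+ 1) 1 * gauss q (suc (e ℕ.+ K′)) 1 + 1ℚ)

  χ-split : χ ≡ η ⊕ κ
  χ-split = trans (cong (predPow p) (sym (ℕ.+-suc e K′))) (predPow-+ p e K)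

  predPow-1 : predPow p 1 ≡ p
  predPow-1 = trans (cong (p ℕ.+_) (ℕ.*-zeroʳ q)) (ℕ.+-identityʳ p)

  q^2K : q ℕ.^ (2 ℕ.* K) ≡ suc κ ℕ.* suc κ
  q^2K = trans (ℕ.^-distribˡ-+-* q K (K ℕ.+ 0))
               (cong₂ ℕ._*_ (sym (suc-predPow p K))
                            (trans (cong (q ℕ.^_) (ℕ.+-identityʳ K)) (sym (suc-predPow p K))))

  g₁-scaled : X * (ℕ→ℚ κ * ℕ→ℚ χ) ≡ P * ℕ→ℚ (κ ℕ.* A p κ η)
  g₁-scaled = begin
    X * (ℕ→ℚ κ * ℕ→ℚ χ)
      ≡⟨ expand (gauss q m K) (gauss q (e ℕ.+ K′) K) (ℕ→ℚ κ) (ℕ→ℚ χ) Q ⟩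
    gauss q m K * ℕ→ℚ κ * ℕ→ℚ χ - Q * (gauss q (e ℕ.+ K′) K * ℕ→ℚ κ * ℕ→ℚ χ)
      ≡⟨ cong₂ (λ x y → x * ℕ→ℚ χ - Q * (y * ℕ→ℚ χ))
               (gauss-absorb u (suc (e ℕ.+ K′)) K′) (gauss-absorb u (suc e′ ℕ.+ K′) K′) ⟩
    c m * P * ℕ→ℚ χ - Q * (c (e ℕ.+ K′) * G₁ * ℕ→ℚ χ)
      ≡⟨ cong (λ y → c m * P * ℕ→ℚ χ - Q * (y * ℕ→ℚ χ)) (sym (gauss-shift p (suc e′) K′)) ⟩
    c m * P * ℕ→ℚ χ - Q * (G₀ * ℕ→ℚ η * ℕ→ℚ χ)
      ≡⟨ regroup (c m) P (ℕ→ℚ χ) Q G₀ (ℕ→ℚ η) ⟩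
    P * (c m * ℕ→ℚ χ) - Q * ℕ→ℚ η * (ℕ→ℚ χ * G₀)
      ≡⟨ cong (λ y → P * (c m * ℕ→ℚ χ) - Q * ℕ→ℚ η * y) (sym (gauss-shift p e K′)) ⟩
    P * (c m * ℕ→ℚ χ) - Q * ℕ→ℚ η * (P * c (suc e))
      ≡⟨ factor-P P (c m * ℕ→ℚ χ) Q (ℕ→ℚ η) (c (suc e)) ⟩
    P * (c m * ℕ→ℚ χ - Q * ℕ→ℚ η * c (suc e))
      ≡⟨ cong (P *_) numerator ⟩
    P * ℕ→ℚ (κ ℕ.* A p κ η) ∎
    where
    Q : ℚ
    Q = ℕ→ℚ (q ℕ.^ (2 ℕ.* K))
    expand : ∀ a b k x Q → (a - Q * b) * (k * x) ≡ a * k * x - Q * (b * k * x)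
    expand = solve 5 (λ a b k x Q → (a :- Q :* b) :* (k :* x) := a :* k :* x :- Q :* (b :* k :* x)) refl
    regroup : ∀ d P x Q G y → d * P * x - Q * (G * y * x) ≡ P * (d * x) - Q * y * (x * G)
    regroup = solve 6 (λ d P x Q G y → d :* P :* x :- Q :* (G :* y :* x) := P :* (d :* x) :- Q :* y :* (x :* G)) refl
    factor-P : ∀ P a Q y d → P * a - Q * y * (P * d) ≡ P * (a - Q * y * d)
    factor-P = solve 5 (λ P a Q y d → P :* a :- Q :* y :* (P :* d) := P :* (a :- Q :* y :* d)) refl
    subtrahend : ℕ
    subtrahend = q ℕ.^ (2 ℕ.* K) ℕ.* η ℕ.* (p ℕ.+ q ℕ.* η)
    identity : (p ℕ.+ q ℕ.* χ) ℕ.* χ ≡ κ ℕ.* A p κ η ℕ.+ subtrahend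
    identity = begin
      (p ℕ.+ q ℕ.* χ) ℕ.* χ
        ≡⟨ cong (λ x → (p ℕ.+ q ℕ.* x) ℕ.* x) χ-split ⟩
      (p ℕ.+ q ℕ.* (η ⊕ κ)) ℕ.* (η ⊕ κ)
        ≡⟨ A-identity p κ η ⟩
      κ ℕ.* A p κ η ℕ.+ suc κ ℕ.* suc κ ℕ.* η ℕ.* (p ℕ.+ q ℕ.* η)
        ≡⟨ cong (λ y → κ ℕ.* A p κ η ℕ.+ y ℕ.* η ℕ.* (p ℕ.+ q ℕ.* η)) (sym q^2K) ⟩
      κ ℕ.* A p κ η ℕ.+ subtrahend ∎
    numerator : c m * ℕ→ℚ χ - Q * ℕ→ℚ η * c (suc e) ≡ ℕ→ℚ (κ ℕ.* A p κ η)
    numerator = begin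
      c m * ℕ→ℚ χ - Q * ℕ→ℚ η * c (suc e)
        ≡⟨ cong₂ _-_ (sym (ℕ→ℚ-* (p ℕ.+ q ℕ.* χ) χ))
                     (sym (ℕ→ℚ-*₃ (q ℕ.^ (2 ℕ.* K)) η (p ℕ.+ q ℕ.* η))) ⟩
      ℕ→ℚ ((p ℕ.+ q ℕ.* χ) ℕ.* χ) - ℕ→ℚ subtrahend
        ≡⟨ cong (λ x → ℕ→ℚ x - ℕ→ℚ subtrahend) identity ⟩
      ℕ→ℚ (κ ℕ.* A p κ η ℕ.+ subtrahend) - ℕ→ℚ subtrahend
        ≡⟨ ℕ→ℚ-+-cancelʳ (κ ℕ.* A p κ η) subtrahend ⟩
      ℕ→ℚ (κ ℕ.* A p κ η) ∎

  g₂-scaled : Y * c 1 ≡ ℕ→ℚ (B p χ τ)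
  g₂-scaled = begin
    Y * c 1
      ≡⟨ distribute (gauss q m 1) (ℕ→ℚ (q ℕ.^ 2)) (gauss q t 1) (c 1) ⟩
    gauss q m 1 * c 1 + ℕ→ℚ (q ℕ.^ 2) * (gauss q t 1 * c 1)
      ≡⟨ cong₂ (λ x y → x + ℕ→ℚ (q ℕ.^ 2) * y) (gauss-one u m) (gauss-one u t) ⟩
    c m + ℕ→ℚ (q ℕ.^ 2) * ℕ→ℚ τ
      ≡⟨ cong (λ n → c m + ℕ→ℚ n * ℕ→ℚ τ) (cong (q ℕ.*_) (ℕ.*-identityʳ q)) ⟩
    c m + ℕ→ℚ (q ℕ.* q) * ℕ→ℚ τ
      ≡⟨ sym (trans (ℕ→ℚ-+ (p ℕ.+ q ℕ.* χ) (q ℕ.* q ℕ.* τ))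
                    (cong (λ x → c m + x) (ℕ→ℚ-* (q ℕ.* q) τ))) ⟩
    ℕ→ℚ (B p χ τ) ∎
    where
    distribute : ∀ a Q b d → (a + Q * b) * d ≡ a * d + Q * (b * d)
    distribute = solve 4 (λ a Q b d → (a :+ Q :* b) :* d := a :* d :+ Q :* (b :* d)) refl

  g₃-scaled : Z * (c 1 * c 1 * ℕ→ℚ χ) ≡ P * ℕ→ℚ (R p χ τ)
  g₃-scaled = begin
    Z * (c 1 * c 1 * ℕ→ℚ χ)
      ≡⟨ distribute P (ℕ→ℚ (q ℕ.^ 1)) Gt Gm (c 1) (ℕ→ℚ χ) ⟩
    P * (ℕ→ℚ (q ℕ.^ 1) * (Gt * c 1) * (Gm * c 1) * ℕ→ℚ χ + c 1 * c 1 * ℕ→ℚ χ)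
      ≡⟨ cong₂ (λ x y → P * (ℕ→ℚ (q ℕ.^ 1) * x * y * ℕ→ℚ χ + c 1 * c 1 * ℕ→ℚ χ))
               (gauss-one u (t ℕ.+ 1)) (gauss-one u (suc (e ℕ.+ K′))) ⟩
    P * (ℕ→ℚ (q ℕ.^ 1) * c (t ℕ.+ 1) * ℕ→ℚ χ * ℕ→ℚ χ + c 1 * c 1 * ℕ→ℚ χ)
      ≡⟨ cong₂ (λ n x → P * (ℕ→ℚ n * ℕ→ℚ x * ℕ→ℚ χ * ℕ→ℚ χ + c 1 * c 1 * ℕ→ℚ χ))
               (ℕ.*-identityʳ q) (cong (predPow p) (ℕ.+-comm t 1)) ⟩
    P * (ℕ→ℚ q * ℕ→ℚ (p ℕ.+ q ℕ.* τ) * ℕ→ℚ χ * ℕ→ℚ χ + c 1 * c 1 * ℕ→ℚ χ)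
      ≡⟨ cong (P *_) (sym cast) ⟩
    P * ℕ→ℚ (R p χ τ) ∎
    where
    Gt Gm : ℚ
    Gt = gauss q (t ℕ.+ 1) 1
    Gm = gauss q (suc (e ℕ.+ K′)) 1
    distribute : ∀ P Q a b d x →
      P * (Q * a * b + 1ℚ) * (d * d * x) ≡ P * (Q * (a * d) * (b * d) * x + d * d * x)
    distribute = solve 6 (λ P Q a b d x → P :* (Q :* a :* b :+ con 1ℚ) :* (d :* d :* x)
                                         := P :* (Q :* (a :* d) :* (b :* d) :* x :+ d :* d :* x)) refl
    cast : ℕ→ℚ (R p χ τ) ≡ ℕ→ℚ q * ℕ→ℚ (p ℕ.+ q ℕ.* τ) * ℕ→ℚ χ * ℕ→ℚ χ + c 1 * c 1 * ℕ→ℚ χ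
    cast = trans (ℕ→ℚ-+ (q ℕ.* (p ℕ.+ q ℕ.* τ) ℕ.* χ ℕ.* χ) (p ℕ.* p ℕ.* χ)) (cong₂ _+_
      (trans (ℕ→ℚ-* (q ℕ.* (p ℕ.+ q ℕ.* τ) ℕ.* χ) χ)
             (cong (_* ℕ→ℚ χ) (ℕ→ℚ-*₃ q (p ℕ.+ q ℕ.* τ) χ)))
      (trans (ℕ→ℚ-*₃ p p χ) (cong (λ x → ℕ→ℚ x * ℕ→ℚ x * ℕ→ℚ χ) (sym predPow-1))))

  -- Multiplying by κχ(q − 1)² > 0 clears the denominators of X, Y and Z, leaving P times naturals.
  gauss-inequality : PolynomialInequality p κ η τ → X * Y < Z
  gauss-inequality p·A·B<R = ℚ.*-cancelʳ-<-nonNeg M {{M-nonNeg}}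
    (subst₂ _<_ (sym left) (sym right) (ℚ.*-monoʳ-<-pos P {{P-pos}} (ℕ→ℚ-mono-< scaled)))
    where
    M : ℚ
    M = ℕ→ℚ κ * ℕ→ℚ χ * (c 1 * c 1)
    P-pos : Positive P
    P-pos = gauss-pos u (suc (e ℕ.+ K′)) K′ (ℕ.≤-trans (ℕ.m≤n+m K′ e) (ℕ.n≤1+n (e ℕ.+ K′)))
    M-nonNeg : NonNegative M
    M-nonNeg = ℚ.nonNeg*nonNeg⇒nonNeg
      (ℕ→ℚ κ * ℕ→ℚ χ) {{ℚ.nonNeg*nonNeg⇒nonNeg (ℕ→ℚ κ) {{ℕ→ℚ-nonNeg κ}}
                                                (ℕ→ℚ χ) {{ℕ→ℚ-nonNeg χ}}}}
      (c 1 * c 1)     {{ℚ.nonNeg*nonNeg⇒nonNeg (c 1) {{ℕ→ℚ-nonNeg (predPow p 1)}}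
                                                (c 1) {{ℕ→ℚ-nonNeg (predPow p 1)}}}}
    scaled : κ ℕ.* A p κ η ℕ.* B p χ τ ℕ.* predPow p 1 ℕ.< κ ℕ.* R p χ τ
    scaled = subst₂ ℕ._<_ reorder refl
      (ℕ.*-monoʳ-< κ (subst (λ x → p ℕ.* A p κ η ℕ.* B p x τ ℕ.< R p x τ) (sym χ-split) p·A·B<R))
      where
      commute : ∀ k p a b → k ℕ.* (p ℕ.* a ℕ.* b) ≡ k ℕ.* a ℕ.* b ℕ.* p
      commute = solve-∀
      reorder : κ ℕ.* (p ℕ.* A p κ η ℕ.* B p χ τ) ≡ κ ℕ.* A p κ η ℕ.* B p χ τ ℕ.* predPow p 1
      reorder = trans (commute κ p (A p κ η) (B p χ τ)) (cong (κ ℕ.* A p κ η ℕ.* B p χ τ ℕ.*_) (sym predPow-1))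
    left : X * Y * M ≡ P * ℕ→ℚ (κ ℕ.* A p κ η ℕ.* B p χ τ ℕ.* predPow p 1)
    left = begin
      X * Y * M
        ≡⟨ regroup X Y (ℕ→ℚ κ) (ℕ→ℚ χ) (c 1) ⟩
      X * (ℕ→ℚ κ * ℕ→ℚ χ) * (Y * c 1) * c 1
        ≡⟨ cong₂ (λ x y → x * y * c 1) g₁-scaled g₂-scaled ⟩
      P * ℕ→ℚ (κ ℕ.* A p κ η) * ℕ→ℚ (B p χ τ) * c 1
        ≡⟨ assoc P (ℕ→ℚ (κ ℕ.* A p κ η)) (ℕ→ℚ (B p χ τ)) (c 1) ⟩
      P * (ℕ→ℚ (κ ℕ.* A p κ η) * ℕ→ℚ (B p χ τ) * c 1)
        ≡⟨ cong (P *_) (sym (ℕ→ℚ-*₃ (κ ℕ.* A p κ η) (B p χ τ) (predPow p 1))) ⟩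
      P * ℕ→ℚ (κ ℕ.* A p κ η ℕ.* B p χ τ ℕ.* predPow p 1) ∎
      where
      regroup : ∀ x y k z d → x * y * (k * z * (d * d)) ≡ x * (k * z) * (y * d) * d
      regroup = solve 5 (λ x y k z d → x :* y :* (k :* z :* (d :* d)) := x :* (k :* z) :* (y :* d) :* d) refl
      assoc : ∀ P a b d → P * a * b * d ≡ P * (a * b * d)
      assoc = solve 4 (λ P a b d → P :* a :* b :* d := P :* (a :* b :* d)) refl
    right : Z * M ≡ P * ℕ→ℚ (κ ℕ.* R p χ τ)
    right = begin
      Z * M                             ≡⟨ regroup Z (ℕ→ℚ κ) (ℕ→ℚ χ) (c 1) ⟩
      ℕ→ℚ κ * (Z * (c 1 * c 1 * ℕ→ℚ χ)) ≡⟨ cong (ℕ→ℚ κ *_) g₃-scaled ⟩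
      ℕ→ℚ κ * (P * ℕ→ℚ (R p χ τ))       ≡⟨ swap (ℕ→ℚ κ) P (ℕ→ℚ (R p χ τ)) ⟩
      P * (ℕ→ℚ κ * ℕ→ℚ (R p χ τ))       ≡⟨ cong (P *_) (sym (ℕ→ℚ-* κ (R p χ τ))) ⟩
      P * ℕ→ℚ (κ ℕ.* R p χ τ)           ∎
      where
      regroup : ∀ z k x d → z * (k * x * (d * d)) ≡ k * (z * (d * d * x))
      regroup = solve 4 (λ z k x d → z :* (k :* x :* (d :* d)) := k :* (z :* (d :* d :* x))) refl
      swap : ∀ k P r → k * (P * r) ≡ P * (k * r)
      swap = solve 3 (λ k P r → k :* (P :* r) := P :* (k :* r)) refl

  g-inequality : PolynomialInequality p κ η τ →
    g₁ q (t ℕ.+ K) (t ℕ.+ 1) (t ℕ.+ m) t * g₂ q (t ℕ.+ 1) (t ℕ.+ m) t < g₃ q (t ℕ.+ K) (t ℕ.+ 1) (t ℕ.+ m) t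
  g-inequality p·A·B<R
    rewrite ℕ.[m+n]∸[m+o]≡n∸o t m 1 | ℕ.+-assoc t 1 1 | ℕ.m+n∸m≡n t 2
          | ℕ.m+n∸m≡n t m | ℕ.m+n∸m≡n t K | ℕ.m+n∸m≡n t 1 = gauss-inequality p·A·B<R

open import Data.Nat using (ℕ; _≥_; _+_)
open import Data.Rational using (_<_; _*_)
open import Data.Product using (_×_)
open import Relation.Nullary using (¬_)
open import Relation.Binary.PropositionalEquality using (_≡_)

primePower≥2 : ∀ {q} → IsPrimePower q → 2 ℕ.≤ q
primePower≥2 (p , zero  , _       , () , _)
primePower≥2 (p , suc e , p-prime , _  , refl) =
  ℕ.≤-trans (ℕ.nonTrivial⇒n>1 p {{prime⇒nonTrivial p-prime}})
            (ℕ.m≤m*n p (p ℕ.^ e) {{ℕ.m^n≢0 p e {{prime⇒nonZero p-prime}}}})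

polynomialInequality : ∀ u t K′ e′ → t ≥ 1
  → ¬ (t + suc K′ ≡ 2 × t + 1 ≡ 2) → ¬ (t + suc K′ ≡ 3 × t + 1 ≡ 2) → ¬ (t + suc K′ ≡ 4 × t + 1 ≡ 2)
  → PolynomialInequality (suc u) (predPow (suc u) (suc K′)) (predPow (suc u) (2 + e′)) (predPow (suc u) t)
polynomialInequality u 1 0 e′ _ ¬2,2 _ _ = ⊥-elim (¬2,2 (refl , refl))
polynomialInequality u 1 1 e′ _ _ ¬3,2 _ = ⊥-elim (¬3,2 (refl , refl))
polynomialInequality u 1 2 e′ _ _ _ ¬4,2 = ⊥-elim (¬4,2 (refl , refl))
polynomialInequality u 1 (suc (suc (suc K))) e′ _ _ _ _ = polynomialInequality-t≡1 u K (predPow (suc u) (2 + e′))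
polynomialInequality u (suc (suc t)) K′ e′ _ _ _ _ = polynomialInequality-t≥2 u K′ e′ t

t+[4+K]≤n : ∀ t K {n} → n ≥ t + 1 + K + (t + 1) + t + 3 → t + (4 + K) ℕ.≤ n
t+[4+K]≤n t K n-large =
  ℕ.≤-trans (ℕ.m≤m+n (t + (4 + K)) (t + t + 1)) (ℕ.≤-trans (ℕ.≤-reflexive (sym (arrange t K))) n-large)
  where
  arrange : ∀ t K → t + 1 + K + (t + 1) + t + 3 ≡ t + (4 + K) + (t + t + 1)
  arrange = solve-∀

t+[4+K]+e≡t+m : ∀ t K e → t + (4 + K) + e ≡ t + suc (suc (suc (suc e) + K))
t+[4+K]+e≡t+m = solve-∀

lemma5p4 : (q n k₁ k₂ t : ℕ) → IsPrimePower q
    → n ≥ 1 → k₁ ≥ 1 → k₂ ≥ 1 → t ≥ 1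
    → n ≥ k₁ + k₂ + t + 3 → k₁ ≥ k₂ → k₂ ≥ t + 1 → k₂ ≡ t + 1
    → ¬ (k₁ ≡ 2 × k₂ ≡ 2) → ¬ (k₁ ≡ 3 × k₂ ≡ 2) → ¬ (k₁ ≡ 4 × k₂ ≡ 2)
    → g₁ q k₁ k₂ n t * g₂ q k₂ n t < g₃ q k₁ k₂ n t
lemma5p4 q n k₁ _ t q-prime-power _ _ _ t≥1 n-large k₁≥k₂ _ refl ¬2,2 ¬3,2 ¬4,2
  with ℕ.m≤n⇒∃[o]m+o≡n (primePower≥2 q-prime-power) | ℕ.m≤n⇒∃[o]m+o≡n k₁≥k₂
... | u , refl | K′ , refl with ℕ.m≤n⇒∃[o]m+o≡n (t+[4+K]≤n t K′ n-large)
...   | e′ , refl rewrite ℕ.+-assoc t 1 K′ | t+[4+K]+e≡t+m t K′ e′ =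
  Reduction.g-inequality u t K′ e′ (polynomialInequality u t K′ e′ t≥1 ¬2,2 ¬3,2 ¬4,2)
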